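{- Let $A\in SL(2,\mathbb Z)$ with $|\operatorname{tr}A|>2$, let $p$ be a prime and $n\in\mathbb Z^2$ (a row vector). Assume that $nA$ and $n$ are linearly independent modulo $p$, and that the eigenvalues of $A$ are distinct modulo $p$ (i.e. the characteristic polynomial of $A$ has distinct roots over an algebraic closure of $\mathbb F_p$). Then the number of $(i,j,k,l)$ with $1\le i,j,k,l\le\operatorname{ord}(A,p)$ and $$n(A^i-A^j+A^k-A^l)\equiv0\pmod p$$ is at most $3\operatorname{ord}(A,p)^2$.
   Context: $\operatorname{ord}(A,N)$ is the least integer $k\ge1$ with $A^k\equiv I\pmod N$. -}

module Defs where

open import Data.Nat as ℕ using (ℕ; zero; suc; _<_; _≤_)
open import Data.Nat.Divisibility as ℕD using ()
open import Data.Integer as ℤ using (ℤ; +_; _+_; _*_; _-_; ∣_∣)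
open import Data.Integer.Divisibility using (_∣_)
open import Data.List using (List; []; _∷_; map; concatMap; filter; length; upTo)
open import Data.Product using (_×_; _,_)
open import Relation.Nullary using (Dec; ¬_)
open import Relation.Nullary.Decidable using (_×-dec_)
open import Relation.Binary.PropositionalEquality using (_≡_)

record M2 : Set where
  constructor mat
  field
    a b c d : ℤ
open M2 public

V2 : Set
V2 = ℤ × ℤ

_⊗_ : M2 → M2 → M2
mat a₁ b₁ c₁ d₁ ⊗ mat a₂ b₂ c₂ d₂ =
  mat (a₁ * a₂ + b₁ * c₂) (a₁ * b₂ + b₁ * d₂)
      (c₁ * a₂ + d₁ * c₂) (c₁ * b₂ + d₁ * d₂)

I₂ : M2
I₂ = mat (+ 1) (+ 0) (+ 0) (+ 1)

_^ᴹ_ : M2 → ℕ → M2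
A ^ᴹ zero = I₂
A ^ᴹ suc k = A ⊗ (A ^ᴹ k)

_⊕_ : M2 → M2 → M2
mat a₁ b₁ c₁ d₁ ⊕ mat a₂ b₂ c₂ d₂ = mat (a₁ + a₂) (b₁ + b₂) (c₁ + c₂) (d₁ + d₂)

_⊖_ : M2 → M2 → M2
mat a₁ b₁ c₁ d₁ ⊖ mat a₂ b₂ c₂ d₂ = mat (a₁ - a₂) (b₁ - b₂) (c₁ - c₂) (d₁ - d₂)

_·_ : V2 → M2 → V2
(x , y) · mat a b c d = (x * a + y * c , x * b + y * d)

tr : M2 → ℤ
tr (mat a b c d) = a + d

det : M2 → ℤ
det (mat a b c d) = a * d - b * c

InSL2 : M2 → Set
InSL2 A = det A ≡ + 1

_≡0[_] : ℤ → ℕ → Set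
x ≡0[ p ] = (+ p) ∣ x

_≡0[_]? : (x : ℤ) (p : ℕ) → Dec (x ≡0[ p ])
x ≡0[ p ]? = p ℕD.∣? ∣ x ∣

V≡0 : V2 → ℕ → Set
V≡0 (x , y) p = (x ≡0[ p ]) × (y ≡0[ p ])

V≡0? : (v : V2) (p : ℕ) → Dec (V≡0 v p)
V≡0? (x , y) p = (x ≡0[ p ]?) ×-dec (y ≡0[ p ]?)

M≡[_] : ℕ → M2 → M2 → Set
M≡[ p ] A B = ((a A - a B) ≡0[ p ]) × ((b A - b B) ≡0[ p ])
            × ((c A - c B) ≡0[ p ]) × ((d A - d B) ≡0[ p ])

IsOrd : M2 → ℕ → ℕ → Set
IsOrd A p k = (1 ≤ k) × M≡[ p ] (A ^ᴹ k) I₂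
            × (∀ m → 1 ≤ m → m < k → ¬ M≡[ p ] (A ^ᴹ m) I₂)

LinIndepMod : ℕ → V2 → V2 → Set
LinIndepMod p (u₁ , u₂) (v₁ , v₂) =
  ∀ (α β : ℤ) → V≡0 (α * u₁ + β * v₁ , α * u₂ + β * v₂) p →
    (α ≡0[ p ]) × (β ≡0[ p ])

-- the characteristic polynomial x² - tr(A) x + det(A) has distinct roots
-- over the algebraic closure of 𝔽_p, i.e. its discriminant is nonzero mod p
DistinctEigenvaluesMod : ℕ → M2 → Set
DistinctEigenvaluesMod p A = ¬ ((tr A * tr A - + 4 * det A) ≡0[ p ])

range1 : ℕ → List ℕ
range1 k = map suc (upTo k)

quads : ℕ → List (ℕ × ℕ × ℕ × ℕ)
quads k = concatMap (λ i → concatMap (λ j → concatMap (λ k' → map (λ l → (i , j , k' , l))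
            (range1 k)) (range1 k)) (range1 k)) (range1 k)

Good : M2 → ℕ → V2 → ℕ × ℕ × ℕ × ℕ → Set
Good A p n (i , j , k , l) =
  V≡0 (n · (((A ^ᴹ i) ⊖ (A ^ᴹ j)) ⊕ ((A ^ᴹ k) ⊖ (A ^ᴹ l)))) p

Good? : (A : M2) (p : ℕ) (n : V2) (t : ℕ × ℕ × ℕ × ℕ) → Dec (Good A p n t)
Good? A p n (i , j , k , l) = V≡0? (n · (((A ^ᴹ i) ⊖ (A ^ᴹ j)) ⊕ ((A ^ᴹ k) ⊖ (A ^ᴹ l)))) p

count : M2 → ℕ → V2 → ℕ → ℕ
count A p n K = length (filter (Good? A p n) (quads K))

{-# OPTIONS --safe #-}
module Submission where

-- Let t = tr A and let θ satisfy θ² = t θ − 1. Since det A = 1, Cayley–Hamilton turns A^m into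
-- α A + β I where α θ + β = θ^m, and because n A and n are independent mod p the congruence
-- n (A^i − A^j + A^k − A^l) ≡ 0 says exactly that x + z = y + w for the powers x, y, z, w of θ
-- in 𝔽_p[θ]. These have norm 1. As t² − 4 ≢ 0 (mod p), four norm-one elements with x + z = y + w
-- satisfy {x, z} = {y, w} or x + z = y + w = 0: multiplying x z − y w by the conjugate of x + z
-- gives N(x + z) (x z − y w) = 0, and when x z = y w, y is a root of (Y − x)(Y − z). Since θ has
-- order K, the powers θ¹, …, θᴷ are distinct, so each of the three families of solutions
-- (i = j and k = l, i = l and k = j, θⁱ + θᵏ = θʲ + θˡ = 0) has at most K² members.

open import Defs

open import Algebra.Bundles.Raw using (RawRing)
open import Data.Fin using (#_)
open import Data.Integer using (∣_∣)
open import Data.Integer.Base using (ℤ; +_; 0ℤ; 1ℤ; +-*-rawRing)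
import Data.Integer.Properties as ℤ
open import Data.Integer.Divisibility.Signed
  using (_∣_; _∣?_; ∣ᵤ⇒∣; ∣⇒∣ᵤ; ∣m∣n⇒∣m+n; ∣n⇒∣m*n)
open import Data.Integer.Tactic.RingSolver using (ring; solve-∀)
open import Data.List
  using (List; []; _∷_; map; filter; length; _++_; cartesianProduct; concatMap; upTo)
open import Data.List.Properties
  using (length-map; length-++; length-++-sucʳ; length-applyUpTo; map-++; map-∘; map-id; concatMap-cong)
open import Data.List.Membership.Propositional using (_∈_)
open import Data.List.Membership.Propositional.Properties
  using (∈-map⁻; ∈-++⁻; ∈-++⁺ˡ; ∈-++⁺ʳ; ∈-∃++; ∈-filter⁻; ∈-filter⁺;
         ∈-cartesianProduct⁺; ∈-cartesianProduct⁻; ∈-upTo⁻)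
open import Data.List.Relation.Binary.Subset.Propositional using (_⊆_)
open import Data.List.Relation.Unary.Any using (here; there)
import Data.List.Relation.Unary.All as All
import Data.List.Relation.Unary.All.Properties as All
open import Data.List.Relation.Unary.Unique.Propositional using (Unique; []; _∷_)
import Data.List.Relation.Unary.Unique.Propositional.Properties as Unique
open import Data.Nat using (ℕ; zero; suc; _≤_; _<_; _∸_; _≟_; z≤n; s≤s)
import Data.Nat.Base as ℕ using (_+_)
import Data.Nat.Divisibility as ℕ using (_∣_; _∣0)
import Data.Nat.Properties as ℕ
open import Data.Nat.Primality using (Prime; euclidsLemma)
open import Data.Product as Product using (_×_; _,_; proj₁; proj₂; uncurry)
open import Data.Sum as Sum using (_⊎_; inj₁; inj₂)
open import Data.Vec using (Vec; _∷_; [])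
open import Function using (_⇔_; mk⇔; Equivalence; id; _∘_)
open import Level using (Level; 0ℓ)
open import Relation.Binary using (Rel; Setoid; tri<; tri≈; tri>)
import Relation.Binary as B
open import Relation.Binary.PropositionalEquality
  using (_≡_; refl; sym; trans; cong; cong₂; subst; module ≡-Reasoning)
import Relation.Binary.Reasoning.Setoid
open import Relation.Nullary using (¬_; contradiction)
open import Relation.Nullary.Decidable using (map′; _×-dec_)
open import Relation.Unary using (Pred; Decidable)
open import Tactic.RingSolver.Core.Expression using (Expr; Κ; Ι)
  renaming (_⊕_ to _+ˢ_; _⊗_ to _*ˢ_; ⊝_ to -ˢ_)
open import Tactic.RingSolver.NonReflective ring using (module Ops)

-- (x₁ , x₂) stands for x₁ θ + x₂ in R[θ]/(θ² − t θ + 1); conj is θ ↦ t − θ, and N x, Tr x are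
-- x · conj x and x + conj x.
module QuadraticAlgebra {c ℓ} (R : RawRing c ℓ) (t : RawRing.Carrier R) where
  open RawRing R

  Q : Set c
  Q = Carrier × Carrier

  infixl 6 _⊞_ _⊟_
  infixl 7 _⊠_ _⋆_
  infix  8 ⊟_
  infixr 9 _^_

  _⊞_ : Q → Q → Q
  (x₁ , x₂) ⊞ (y₁ , y₂) = (x₁ + y₁ , x₂ + y₂)

  ⊟_ : Q → Q
  ⊟ (x₁ , x₂) = (- x₁ , - x₂)

  _⊟_ : Q → Q → Q
  x ⊟ y = x ⊞ ⊟ y

  _⋆_ : Carrier → Q → Q
  c ⋆ (x₁ , x₂) = (c * x₁ , c * x₂)

  _⊠_ : Q → Q → Q
  (x₁ , x₂) ⊠ (y₁ , y₂) = (t * x₁ * y₁ + x₁ * y₂ + x₂ * y₁ , x₂ * y₂ + - (x₁ * y₁))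

  conj : Q → Q
  conj (x₁ , x₂) = (- x₁ , t * x₁ + x₂)

  N : Q → Carrier
  N (x₁ , x₂) = x₁ * x₁ + t * x₁ * x₂ + x₂ * x₂

  Tr : Q → Carrier
  Tr (x₁ , x₂) = t * x₁ + (x₂ + x₂)

  𝟘 𝟙 θ : Q
  𝟘 = (0# , 0#)
  𝟙 = (0# , 1#)
  θ = (1# , 0#)

  _^_ : Q → ℕ → Q
  x ^ zero  = 𝟙
  x ^ suc m = x ⊠ x ^ m

module Congruence (p : ℕ) where
  open import Data.Integer.Base using (_+_; _*_; _-_; -_)

  -- A record rather than a synonym for + p ∣ x - y, so that x and y can be inferred from a proof.
  infix 4 _≈_
  record _≈_ (x y : ℤ) : Set where
    constructor mk≈
    field
      p∣x-y : + p ∣ x - y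

  private
    by-identity : ∀ {x y u} → x - y ≡ u → + p ∣ u → x ≈ y
    by-identity refl p∣u = mk≈ p∣u

  ≈-refl : ∀ {x} → x ≈ x
  ≈-refl {x} = by-identity (ℤ.+-inverseʳ x) (∣ᵤ⇒∣ (p ℕ.∣0))

  ≈-sym : ∀ {x y} → x ≈ y → y ≈ x
  ≈-sym {x} {y} (mk≈ p∣x-y) = by-identity (identity x y) (∣n⇒∣m*n (- 1ℤ) p∣x-y)
    where
    identity : ∀ x y → y - x ≡ - 1ℤ * (x - y)
    identity = solve-∀

  ≈-trans : ∀ {x y z} → x ≈ y → y ≈ z → x ≈ z
  ≈-trans {x} {y} {z} (mk≈ p∣x-y) (mk≈ p∣y-z) =
    by-identity (identity x y z) (∣m∣n⇒∣m+n p∣x-y p∣y-z)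
    where
    identity : ∀ x y z → x - z ≡ (x - y) + (y - z)
    identity = solve-∀

  ≈-reflexive : ∀ {x y} → x ≡ y → x ≈ y
  ≈-reflexive refl = ≈-refl

  ≈-setoid : Setoid 0ℓ 0ℓ
  ≈-setoid = record
    { Carrier = ℤ ; _≈_ = _≈_
    ; isEquivalence = record { refl = ≈-refl ; sym = ≈-sym ; trans = ≈-trans }
    }

  module ≈-Reasoning = Relation.Binary.Reasoning.Setoid ≈-setoid

  infix 4 _≈?_
  _≈?_ : B.Decidable _≈_
  x ≈? y = map′ mk≈ _≈_.p∣x-y (+ p ∣? x - y)

  +-cong : ∀ {x y u v} → x ≈ y → u ≈ v → x + u ≈ y + v
  +-cong {x} {y} {u} {v} (mk≈ p∣x-y) (mk≈ p∣u-v) =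
    by-identity (identity x y u v) (∣m∣n⇒∣m+n p∣x-y p∣u-v)
    where
    identity : ∀ x y u v → (x + u) - (y + v) ≡ (x - y) + (u - v)
    identity = solve-∀

  -‿cong : ∀ {x y} → x ≈ y → - x ≈ - y
  -‿cong {x} {y} (mk≈ p∣x-y) = by-identity (identity x y) (∣n⇒∣m*n (- 1ℤ) p∣x-y)
    where
    identity : ∀ x y → - x - - y ≡ - 1ℤ * (x - y)
    identity = solve-∀

  *-cong : ∀ {x y u v} → x ≈ y → u ≈ v → x * u ≈ y * v
  *-cong {x} {y} {u} {v} (mk≈ p∣x-y) (mk≈ p∣u-v) =
    by-identity (identity x y u v) (∣m∣n⇒∣m+n (∣n⇒∣m*n u p∣x-y) (∣n⇒∣m*n y p∣u-v))
    where
    identity : ∀ x y u v → x * u - y * v ≡ u * (x - y) + y * (u - v)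
    identity = solve-∀

  x-y≈0⇒x≈y : ∀ {x y} → x - y ≈ 0ℤ → x ≈ y
  x-y≈0⇒x≈y {x} {y} (mk≈ p∣x-y-0) = by-identity (sym (ℤ.+-identityʳ (x - y))) p∣x-y-0

  ≈⇔≡0 : ∀ {x y} → x ≈ y ⇔ (x - y) ≡0[ p ]
  ≈⇔≡0 = mk⇔ (∣⇒∣ᵤ ∘ _≈_.p∣x-y) (mk≈ ∘ ∣ᵤ⇒∣)

  ≈0⇔≡0 : ∀ {x} → x ≈ 0ℤ ⇔ x ≡0[ p ]
  ≈0⇔≡0 {x} = mk⇔ (λ (mk≈ p∣x-0) → ∣⇒∣ᵤ (subst (+ p ∣_) (ℤ.+-identityʳ x) p∣x-0))
                  (λ p∣x → by-identity (ℤ.+-identityʳ x) (∣ᵤ⇒∣ p∣x))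

  ≡0-linear : ∀ x y e f → e ≡0[ p ] → f ≡0[ p ] → (x * e + y * f) ≡0[ p ]
  ≡0-linear x y e f p∣e p∣f =
    ∣⇒∣ᵤ (∣m∣n⇒∣m+n {+ p} {x * e} {y * f} (∣n⇒∣m*n x (∣ᵤ⇒∣ p∣e)) (∣n⇒∣m*n y (∣ᵤ⇒∣ p∣f)))

  module _ (prime : Prime p) where

    *≈0⇒ : ∀ {x y} → x * y ≈ 0ℤ → x ≈ 0ℤ ⊎ y ≈ 0ℤ
    *≈0⇒ {x} {y} xy≈0 =
      Sum.map (from ≈0⇔≡0) (from ≈0⇔≡0)
        (euclidsLemma ∣ x ∣ ∣ y ∣ prime (subst (p ℕ.∣_) (ℤ.abs-* x y) (to ≈0⇔≡0 xy≈0)))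
      where open Equivalence

    x*x≈0⇒x≈0 : ∀ {x} → x * x ≈ 0ℤ → x ≈ 0ℤ
    x*x≈0⇒x≈0 {x} x*x≈0 = Sum.[ id , id ]′ (*≈0⇒ {x} {x} x*x≈0)

    *-cancelˡ-≈ : ∀ {c x y} → c * x ≈ c * y → c ≈ 0ℤ ⊎ x ≈ y
    *-cancelˡ-≈ {c} {x} {y} (mk≈ p∣cx-cy) =
      Sum.map₂ x-y≈0⇒x≈y (*≈0⇒ (by-identity (identity c x y) p∣cx-cy))
      where
      identity : ∀ c x y → c * (x - y) - 0ℤ ≡ c * x - c * y
      identity = solve-∀

-- Identities in ℤ[θ] are proved by the ring solver: both sides are built with the operations of
-- QuadraticAlgebra over solver syntax in the variables t, x₁, x₂, y₁, y₂, z₁, z₂, w₁, w₂, and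
-- evaluating that syntax computes to the same sides over ℤ.
private
  syntaxRing : RawRing 0ℓ 0ℓ
  syntaxRing = record
    { Carrier = Expr ℤ 9 ; _≈_ = _≡_
    ; _+_ = _+ˢ_ ; _*_ = _*ˢ_ ; -_ = -ˢ_ ; 0# = Κ 0ℤ ; 1# = Κ 1ℤ
    }

  module Syntax = QuadraticAlgebra syntaxRing (Ι (# 0)) hiding (_^_)
    renaming (Q to Qˢ; _⊞_ to _⊞ˢ_; ⊟_ to ⊟ˢ_; _⊟_ to _⊟ˢ_; _⋆_ to _⋆ˢ_; _⊠_ to _⊠ˢ_;
              conj to conjˢ; N to Nˢ; Tr to Trˢ; 𝟘 to 𝟘ˢ; 𝟙 to 𝟙ˢ; θ to θˢ)

module QuadraticInteger (t : ℤ) where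
  open import Data.Integer.Base using (_+_; _*_; _-_; -_)
  open QuadraticAlgebra +-*-rawRing t public

  private
    open Syntax

    tˢ : Expr ℤ 9
    tˢ = Ι (# 0)

    xˢ yˢ zˢ wˢ : Qˢ
    xˢ = Ι (# 1) , Ι (# 2)
    yˢ = Ι (# 3) , Ι (# 4)
    zˢ = Ι (# 5) , Ι (# 6)
    wˢ = Ι (# 7) , Ι (# 8)

    env : Q → Q → Q → Q → Vec ℤ 9
    env (x₁ , x₂) (y₁ , y₂) (z₁ , z₂) (w₁ , w₂) = t ∷ x₁ ∷ x₂ ∷ y₁ ∷ y₂ ∷ z₁ ∷ z₂ ∷ w₁ ∷ w₂ ∷ []

    ℤ-identity : ∀ (l r : Expr ℤ 9) x y z w → (∀ ρ → Ops.⟦ l ⇓⟧ ρ ≡ Ops.⟦ r ⇓⟧ ρ) →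
                 Ops.⟦ l ⟧ (env x y z w) ≡ Ops.⟦ r ⟧ (env x y z w)
    ℤ-identity l r x y z w l≡r = Ops.prove (env x y z w) l r (l≡r (env x y z w))

    Q-identity : ∀ (l r : Qˢ) x y z w →
                 (∀ ρ → (Ops.⟦ proj₁ l ⇓⟧ ρ , Ops.⟦ proj₂ l ⇓⟧ ρ) ≡ (Ops.⟦ proj₁ r ⇓⟧ ρ , Ops.⟦ proj₂ r ⇓⟧ ρ)) →
                 (Ops.⟦ proj₁ l ⟧ (env x y z w) , Ops.⟦ proj₂ l ⟧ (env x y z w))
                   ≡ (Ops.⟦ proj₁ r ⟧ (env x y z w) , Ops.⟦ proj₂ r ⟧ (env x y z w))
    Q-identity (l₁ , l₂) (r₁ , r₂) x y z w l≡r =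
      cong₂ _,_ (ℤ-identity l₁ r₁ x y z w (cong proj₁ ∘ l≡r)) (ℤ-identity l₂ r₂ x y z w (cong proj₂ ∘ l≡r))

  ⊞-comm : ∀ x y → x ⊞ y ≡ y ⊞ x
  ⊞-comm x y = Q-identity (xˢ ⊞ˢ yˢ) (yˢ ⊞ˢ xˢ) x y 𝟘 𝟘 (λ _ → refl)

  ⊞-identityˡ : ∀ x → 𝟘 ⊞ x ≡ x
  ⊞-identityˡ x = Q-identity (𝟘ˢ ⊞ˢ xˢ) xˢ x 𝟘 𝟘 𝟘 (λ _ → refl)

  ⊞-identityʳ : ∀ x → x ⊞ 𝟘 ≡ x
  ⊞-identityʳ x = Q-identity (xˢ ⊞ˢ 𝟘ˢ) xˢ x 𝟘 𝟘 𝟘 (λ _ → refl)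

  ⊟-inverseˡ : ∀ x → ⊟ x ⊞ x ≡ 𝟘
  ⊟-inverseˡ x = Q-identity (⊟ˢ xˢ ⊞ˢ xˢ) 𝟘ˢ x 𝟘 𝟘 𝟘 (λ _ → refl)

  ⊟-inverseʳ : ∀ x → x ⊟ x ≡ 𝟘
  ⊟-inverseʳ x = Q-identity (xˢ ⊟ˢ xˢ) 𝟘ˢ x 𝟘 𝟘 𝟘 (λ _ → refl)

  ⊟-⊟ : ∀ x y → x ⊟ ⊟ y ≡ x ⊞ y
  ⊟-⊟ x y = Q-identity (xˢ ⊟ˢ ⊟ˢ yˢ) (xˢ ⊞ˢ yˢ) x y 𝟘 𝟘 (λ _ → refl)

  ⊞-⊟-cancelˡ : ∀ x y → (x ⊞ y) ⊟ x ≡ y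
  ⊞-⊟-cancelˡ x y = Q-identity ((xˢ ⊞ˢ yˢ) ⊟ˢ xˢ) yˢ x y 𝟘 𝟘 (λ _ → refl)

  ⊟-⊞-cancelʳ : ∀ x y → (x ⊟ y) ⊞ y ≡ x
  ⊟-⊞-cancelʳ x y = Q-identity ((xˢ ⊟ˢ yˢ) ⊞ˢ yˢ) xˢ x y 𝟘 𝟘 (λ _ → refl)

  alternating-sum : ∀ x y z w → x ⊞ z ≡ ((x ⊟ y) ⊞ (z ⊟ w)) ⊞ (y ⊞ w)
  alternating-sum x y z w =
    Q-identity (xˢ ⊞ˢ zˢ) (((xˢ ⊟ˢ yˢ) ⊞ˢ (zˢ ⊟ˢ wˢ)) ⊞ˢ (yˢ ⊞ˢ wˢ)) x y z w (λ _ → refl)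

  ⋆-identityˡ : ∀ x → 1ℤ ⋆ x ≡ x
  ⋆-identityˡ x = Q-identity (Κ 1ℤ ⋆ˢ xˢ) xˢ x 𝟘 𝟘 𝟘 (λ _ → refl)

  ⊠-identityˡ : ∀ x → 𝟙 ⊠ x ≡ x
  ⊠-identityˡ x = Q-identity (𝟙ˢ ⊠ˢ xˢ) xˢ x 𝟘 𝟘 𝟘 (λ _ → refl)

  ⊠-zeroʳ : ∀ x → x ⊠ 𝟘 ≡ 𝟘
  ⊠-zeroʳ x = Q-identity (xˢ ⊠ˢ 𝟘ˢ) 𝟘ˢ x 𝟘 𝟘 𝟘 (λ _ → refl)

  θ-⊠ : ∀ x → θ ⊠ x ≡ (t * proj₁ x + proj₂ x , - proj₁ x)
  θ-⊠ x = Q-identity (θˢ ⊠ˢ xˢ) (tˢ *ˢ proj₁ xˢ +ˢ proj₂ xˢ , -ˢ proj₁ xˢ) x 𝟘 𝟘 𝟘 (λ _ → refl)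

  ⊟-⊠-⊟ : ∀ x y z w → (y ⊟ x) ⊠ (y ⊟ z) ≡ y ⊠ ((y ⊞ w) ⊟ (x ⊞ z)) ⊞ (x ⊠ z ⊟ y ⊠ w)
  ⊟-⊠-⊟ x y z w =
    Q-identity ((yˢ ⊟ˢ xˢ) ⊠ˢ (yˢ ⊟ˢ zˢ)) (yˢ ⊠ˢ ((yˢ ⊞ˢ wˢ) ⊟ˢ (xˢ ⊞ˢ zˢ)) ⊞ˢ (xˢ ⊠ˢ zˢ ⊟ˢ yˢ ⊠ˢ wˢ))
               x y z w (λ _ → refl)

  N-𝟘 : N 𝟘 ≡ 0ℤ
  N-𝟘 = ℤ-identity (Nˢ 𝟘ˢ) (Κ 0ℤ) 𝟘 𝟘 𝟘 𝟘 (λ _ → refl)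

  N-𝟙 : N 𝟙 ≡ 1ℤ
  N-𝟙 = ℤ-identity (Nˢ 𝟙ˢ) (Κ 1ℤ) 𝟘 𝟘 𝟘 𝟘 (λ _ → refl)

  N-⊟ : ∀ x → N (⊟ x) ≡ N x
  N-⊟ x = ℤ-identity (Nˢ (⊟ˢ xˢ)) (Nˢ xˢ) x 𝟘 𝟘 𝟘 (λ _ → refl)

  N-conj : ∀ x → N (conj x) ≡ N x
  N-conj x = ℤ-identity (Nˢ (conjˢ xˢ)) (Nˢ xˢ) x 𝟘 𝟘 𝟘 (λ _ → refl)

  N-⊠ : ∀ x y → N (x ⊠ y) ≡ N x * N y
  N-⊠ x y = ℤ-identity (Nˢ (xˢ ⊠ˢ yˢ)) (Nˢ xˢ *ˢ Nˢ yˢ) x y 𝟘 𝟘 (λ _ → refl)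

  N-θ⊠ : ∀ x → N (θ ⊠ x) ≡ N x
  N-θ⊠ x = ℤ-identity (Nˢ (θˢ ⊠ˢ xˢ)) (Nˢ xˢ) x 𝟘 𝟘 𝟘 (λ _ → refl)

  N-θ^ : ∀ m → N (θ ^ m) ≡ 1ℤ
  N-θ^ zero    = N-𝟙
  N-θ^ (suc m) = trans (N-θ⊠ (θ ^ m)) (N-θ^ m)

  ⊠-conj-cancelˡ : ∀ x y → x ⊠ (conj x ⊠ y) ≡ N x ⋆ y
  ⊠-conj-cancelˡ x y = Q-identity (xˢ ⊠ˢ (conjˢ xˢ ⊠ˢ yˢ)) (Nˢ xˢ ⋆ˢ yˢ) x y 𝟘 𝟘 (λ _ → refl)

  ⊠-conj-cancelʳ : ∀ x y → (x ⊠ conj y) ⊠ y ≡ N y ⋆ x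
  ⊠-conj-cancelʳ x y = Q-identity ((xˢ ⊠ˢ conjˢ yˢ) ⊠ˢ yˢ) (Nˢ yˢ ⋆ˢ xˢ) x y 𝟘 𝟘 (λ _ → refl)

  conj-⊞-⊠ : ∀ x z → conj (x ⊞ z) ⊠ (x ⊠ z) ≡ N z ⋆ x ⊞ N x ⋆ z
  conj-⊞-⊠ x z =
    Q-identity (conjˢ (xˢ ⊞ˢ zˢ) ⊠ˢ (xˢ ⊠ˢ zˢ)) (Nˢ zˢ ⋆ˢ xˢ ⊞ˢ Nˢ xˢ ⋆ˢ zˢ) x 𝟘 z 𝟘 (λ _ → refl)

  Tr-⊠-conj : ∀ x y → Tr (x ⊠ conj y) ≡ N x + N y - N (x ⊟ y)
  Tr-⊠-conj x y =
    ℤ-identity (Trˢ (xˢ ⊠ˢ conjˢ yˢ)) (Nˢ xˢ +ˢ Nˢ yˢ +ˢ -ˢ Nˢ (xˢ ⊟ˢ yˢ)) x y 𝟘 𝟘 (λ _ → refl)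

  discriminant : ∀ x → (t * t - + 4) * (proj₁ x * proj₁ x) ≡ Tr x * Tr x - + 4 * N x
  discriminant x =
    ℤ-identity ((tˢ *ˢ tˢ +ˢ -ˢ Κ (+ 4)) *ˢ (proj₁ xˢ *ˢ proj₁ xˢ))
               (Trˢ xˢ *ˢ Trˢ xˢ +ˢ -ˢ (Κ (+ 4) *ˢ Nˢ xˢ)) x 𝟘 𝟘 𝟘 (λ _ → refl)

  unipotent-identity : ∀ x → (proj₂ x - 1ℤ) * (proj₂ x - 1ℤ)
                             ≡ N x - Tr x + 1ℤ - proj₁ x * (proj₁ x + t * proj₂ x - t)
  unipotent-identity x =
    ℤ-identity ((proj₂ xˢ +ˢ -ˢ Κ 1ℤ) *ˢ (proj₂ xˢ +ˢ -ˢ Κ 1ℤ))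
               (Nˢ xˢ +ˢ -ˢ Trˢ xˢ +ˢ Κ 1ℤ +ˢ -ˢ (proj₁ xˢ *ˢ (proj₁ xˢ +ˢ tˢ *ˢ proj₂ xˢ +ˢ -ˢ tˢ)))
               x 𝟘 𝟘 𝟘 (λ _ → refl)

module QuadraticModP (p : ℕ) (t : ℤ) where
  open import Data.Integer.Base using (_+_; _*_; _-_; -_)
  open Congruence p
  open QuadraticInteger t public

  infix 4 _≋_
  record _≋_ (x y : Q) : Set where
    constructor _,_
    field
      ≈₁ : proj₁ x ≈ proj₁ y
      ≈₂ : proj₂ x ≈ proj₂ y

  ≋-refl : ∀ {x} → x ≋ x
  ≋-refl = ≈-refl , ≈-refl

  ≋-sym : ∀ {x y} → x ≋ y → y ≋ x
  ≋-sym (x₁≈y₁ , x₂≈y₂) = ≈-sym x₁≈y₁ , ≈-sym x₂≈y₂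

  ≋-trans : ∀ {x y z} → x ≋ y → y ≋ z → x ≋ z
  ≋-trans (x₁≈y₁ , x₂≈y₂) (y₁≈z₁ , y₂≈z₂) = ≈-trans x₁≈y₁ y₁≈z₁ , ≈-trans x₂≈y₂ y₂≈z₂

  ≋-reflexive : ∀ {x y} → x ≡ y → x ≋ y
  ≋-reflexive refl = ≋-refl

  ≋-setoid : Setoid 0ℓ 0ℓ
  ≋-setoid = record
    { Carrier = Q ; _≈_ = _≋_
    ; isEquivalence = record { refl = ≋-refl ; sym = ≋-sym ; trans = ≋-trans }
    }

  module ≋-Reasoning = Relation.Binary.Reasoning.Setoid ≋-setoid

  infix 4 _≋?_
  _≋?_ : B.Decidable _≋_
  (x₁ , x₂) ≋? (y₁ , y₂) =
    map′ (uncurry _,_) (λ (x₁≈y₁ , x₂≈y₂) → x₁≈y₁ , x₂≈y₂) ((x₁ ≈? y₁) ×-dec (x₂ ≈? y₂))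

  ⊞-cong : ∀ {x x′ y y′} → x ≋ x′ → y ≋ y′ → x ⊞ y ≋ x′ ⊞ y′
  ⊞-cong (x₁ , x₂) (y₁ , y₂) = +-cong x₁ y₁ , +-cong x₂ y₂

  ⊟-cong : ∀ {x x′} → x ≋ x′ → ⊟ x ≋ ⊟ x′
  ⊟-cong (x₁ , x₂) = -‿cong x₁ , -‿cong x₂

  ⋆-congʳ : ∀ x {c c′} → c ≈ c′ → c ⋆ x ≋ c′ ⋆ x
  ⋆-congʳ _ c≈c′ = *-cong c≈c′ ≈-refl , *-cong c≈c′ ≈-refl

  ⊠-cong : ∀ {x x′ y y′} → x ≋ x′ → y ≋ y′ → x ⊠ y ≋ x′ ⊠ y′
  ⊠-cong (x₁ , x₂) (y₁ , y₂) =
    +-cong (+-cong (*-cong (*-cong (≈-refl {t}) x₁) y₁) (*-cong x₁ y₂)) (*-cong x₂ y₁) ,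
    +-cong (*-cong x₂ y₂) (-‿cong (*-cong x₁ y₁))

  ⊠-congˡ : ∀ x {y y′} → y ≋ y′ → x ⊠ y ≋ x ⊠ y′
  ⊠-congˡ x = ⊠-cong (≋-refl {x})

  ⊠-congʳ : ∀ y {x x′} → x ≋ x′ → x ⊠ y ≋ x′ ⊠ y
  ⊠-congʳ y x≋x′ = ⊠-cong x≋x′ (≋-refl {y})

  conj-cong : ∀ {x x′} → x ≋ x′ → conj x ≋ conj x′
  conj-cong (x₁ , x₂) = -‿cong x₁ , +-cong (*-cong (≈-refl {t}) x₁) x₂

  N-cong : ∀ {x x′} → x ≋ x′ → N x ≈ N x′
  N-cong (x₁ , x₂) = +-cong (+-cong (*-cong x₁ x₁) (*-cong (*-cong (≈-refl {t}) x₁) x₂)) (*-cong x₂ x₂)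

  ≋⇒⊟≋𝟘 : ∀ {x y} → x ≋ y → x ⊟ y ≋ 𝟘
  ≋⇒⊟≋𝟘 {x} {y} x≋y = begin
    x ⊟ y  ≈⟨ ⊞-cong x≋y (≋-refl {⊟ y}) ⟩
    y ⊟ y  ≡⟨ ⊟-inverseʳ y ⟩
    𝟘      ∎
    where open ≋-Reasoning

  ⊟≋𝟘⇒≋ : ∀ {x y} → x ⊟ y ≋ 𝟘 → x ≋ y
  ⊟≋𝟘⇒≋ {x} {y} x-y≋𝟘 = begin
    x            ≡⟨ ⊟-⊞-cancelʳ x y ⟨
    (x ⊟ y) ⊞ y  ≈⟨ ⊞-cong x-y≋𝟘 (≋-refl {y}) ⟩
    𝟘 ⊞ y        ≡⟨ ⊞-identityˡ y ⟩
    y            ∎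
    where open ≋-Reasoning

  alternating≋𝟘⇒ : ∀ x y z w → (x ⊟ y) ⊞ (z ⊟ w) ≋ 𝟘 → x ⊞ z ≋ y ⊞ w
  alternating≋𝟘⇒ x y z w e≋𝟘 = begin
    x ⊞ z                          ≡⟨ alternating-sum x y z w ⟩
    ((x ⊟ y) ⊞ (z ⊟ w)) ⊞ (y ⊞ w)  ≈⟨ ⊞-cong e≋𝟘 (≋-refl {y ⊞ w}) ⟩
    𝟘 ⊞ (y ⊞ w)                    ≡⟨ ⊞-identityˡ (y ⊞ w) ⟩
    y ⊞ w                          ∎
    where open ≋-Reasoning

  ⊞-cancelˡ : ∀ x y z w → x ⊞ z ≋ y ⊞ w → x ≋ y → z ≋ w
  ⊞-cancelˡ x y z w x+z≋y+w x≋y = begin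
    z            ≡⟨ ⊞-⊟-cancelˡ x z ⟨
    (x ⊞ z) ⊟ x  ≈⟨ ⊞-cong x+z≋y+w (⊟-cong x≋y) ⟩
    (y ⊞ w) ⊟ y  ≡⟨ ⊞-⊟-cancelˡ y w ⟩
    w            ∎
    where open ≋-Reasoning

  module _ {g : Q} {K : ℕ} (g^K≋𝟙 : g ^ K ≋ 𝟙) (g^m≉𝟙 : ∀ m → 1 ≤ m → m < K → ¬ g ^ m ≋ 𝟙) where

    private
      ^-shift : ∀ r {i j} → g ^ i ≋ g ^ j → g ^ (r ℕ.+ i) ≋ g ^ (r ℕ.+ j)
      ^-shift zero    gⁱ≋gʲ = gⁱ≋gʲ
      ^-shift (suc r) gⁱ≋gʲ = ⊠-congˡ g (^-shift r gⁱ≋gʲ)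

      ^-distinct : ∀ {i j} → 1 ≤ i → i < j → j ≤ K → ¬ g ^ i ≋ g ^ j
      ^-distinct {i} {j} 1≤i i<j j≤K gⁱ≋gʲ =
        g^m≉𝟙 (K ∸ j ℕ.+ i) (ℕ.≤-trans 1≤i (ℕ.m≤n+m i (K ∸ j))) K∸j+i<K
          (≋-trans (^-shift (K ∸ j) gⁱ≋gʲ) (subst (λ m → g ^ m ≋ 𝟙) (sym (ℕ.m∸n+n≡m j≤K)) g^K≋𝟙))
        where
        K∸j+i<K : K ∸ j ℕ.+ i < K
        K∸j+i<K = ℕ.<-≤-trans (ℕ.+-monoʳ-< (K ∸ j) i<j) (ℕ.≤-reflexive (ℕ.m∸n+n≡m j≤K))

    ^-injective : ∀ {i j} → 1 ≤ i → i ≤ K → 1 ≤ j → j ≤ K → g ^ i ≋ g ^ j → i ≡ j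
    ^-injective {i} {j} 1≤i i≤K 1≤j j≤K gⁱ≋gʲ with ℕ.<-cmp i j
    ... | tri< i<j _ _ = contradiction gⁱ≋gʲ (^-distinct 1≤i i<j j≤K)
    ... | tri≈ _ i≡j _ = i≡j
    ... | tri> _ _ j<i = contradiction (≋-sym gⁱ≋gʲ) (^-distinct 1≤j j<i i≤K)

  module _ (prime : Prime p) where

    ⋆-cancel : ∀ {c x y} → c ⋆ x ≋ c ⋆ y → c ≈ 0ℤ ⊎ x ≋ y
    ⋆-cancel {c} {x₁ , x₂} {y₁ , y₂} (cx₁≈cy₁ , cx₂≈cy₂) =
      both (*-cancelˡ-≈ prime {c} {x₁} {y₁} cx₁≈cy₁) (*-cancelˡ-≈ prime {c} {x₂} {y₂} cx₂≈cy₂)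
      where
      both : c ≈ 0ℤ ⊎ x₁ ≈ y₁ → c ≈ 0ℤ ⊎ x₂ ≈ y₂ → c ≈ 0ℤ ⊎ (x₁ , x₂) ≋ (y₁ , y₂)
      both (inj₁ c≈0)   _            = inj₁ c≈0
      both (inj₂ _)     (inj₁ c≈0)   = inj₁ c≈0
      both (inj₂ x₁≈y₁) (inj₂ x₂≈y₂) = inj₂ (x₁≈y₁ , x₂≈y₂)

    module _ (t²-4≉0 : ¬ t * t - + 4 ≈ 0ℤ) where

      unipotent⇒≋𝟙 : ∀ u → N u ≈ 1ℤ → Tr u ≈ + 2 → u ≋ 𝟙
      unipotent⇒≋𝟙 u@(u₁ , u₂) Nu≈1 Tru≈2 = u₁≈0 , u₂≈1
        where
        open ≈-Reasoning

        u₁≈0 : u₁ ≈ 0ℤ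
        u₁≈0 with *≈0⇒ prime (begin
            (t * t - + 4) * (u₁ * u₁)  ≡⟨ discriminant u ⟩
            Tr u * Tr u - + 4 * N u     ≈⟨ +-cong (*-cong Tru≈2 Tru≈2) (-‿cong (*-cong (≈-refl {+ 4}) Nu≈1)) ⟩
            + 2 * + 2 - + 4 * 1ℤ        ≡⟨⟩
            0ℤ                          ∎)
        ... | inj₁ t²-4≈0 = contradiction t²-4≈0 t²-4≉0
        ... | inj₂ u₁²≈0  = x*x≈0⇒x≈0 prime u₁²≈0

        u₂≈1 : u₂ ≈ 1ℤ
        u₂≈1 = x-y≈0⇒x≈y (x*x≈0⇒x≈0 prime (begin
          (u₂ - 1ℤ) * (u₂ - 1ℤ)                       ≡⟨ unipotent-identity u ⟩
          N u - Tr u + 1ℤ - u₁ * (u₁ + t * u₂ - t)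
            ≈⟨ +-cong (+-cong (+-cong Nu≈1 (-‿cong Tru≈2)) ≈-refl) (-‿cong (*-cong u₁≈0 ≈-refl)) ⟩
          1ℤ - + 2 + 1ℤ - 0ℤ * (u₁ + t * u₂ - t)      ≡⟨⟩
          0ℤ                                          ∎))

      N[x⊟y]≈0⇒x≋y : ∀ x y → N x ≈ 1ℤ → N y ≈ 1ℤ → N (x ⊟ y) ≈ 0ℤ → x ≋ y
      N[x⊟y]≈0⇒x≋y x y Nx≈1 Ny≈1 Nx-y≈0 = begin
        x                 ≡⟨ ⋆-identityˡ x ⟨
        1ℤ ⋆ x            ≈⟨ ⋆-congʳ x Ny≈1 ⟨
        N y ⋆ x           ≡⟨ ⊠-conj-cancelʳ x y ⟨
        (x ⊠ conj y) ⊠ y  ≈⟨ ⊠-congʳ y (unipotent⇒≋𝟙 (x ⊠ conj y) Nu≈1 Tru≈2) ⟩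
        𝟙 ⊠ y             ≡⟨ ⊠-identityˡ y ⟩
        y                 ∎
        where
        open ≋-Reasoning

        Nu≈1 : N (x ⊠ conj y) ≈ 1ℤ
        Nu≈1 = ≈-trans (≈-reflexive (trans (N-⊠ x (conj y)) (cong (N x *_) (N-conj y))))
                       (*-cong Nx≈1 Ny≈1)

        Tru≈2 : Tr (x ⊠ conj y) ≈ + 2
        Tru≈2 = ≈-trans (≈-reflexive (Tr-⊠-conj x y)) (+-cong (+-cong Nx≈1 Ny≈1) (-‿cong Nx-y≈0))

      N[x⊞z]≈0⇒x⊞z≋𝟘 : ∀ x z → N x ≈ 1ℤ → N z ≈ 1ℤ → N (x ⊞ z) ≈ 0ℤ → x ⊞ z ≋ 𝟘
      N[x⊞z]≈0⇒x⊞z≋𝟘 x z Nx≈1 Nz≈1 Nx+z≈0 = begin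
        x ⊞ z    ≈⟨ ⊞-cong x≋⊟z (≋-refl {z}) ⟩
        ⊟ z ⊞ z  ≡⟨ ⊟-inverseˡ z ⟩
        𝟘        ∎
        where
        open ≋-Reasoning
        x≋⊟z : x ≋ ⊟ z
        x≋⊟z = N[x⊟y]≈0⇒x≋y x (⊟ z) Nx≈1 (≈-trans (≈-reflexive (N-⊟ z)) Nz≈1)
                 (subst (λ v → N v ≈ 0ℤ) (sym (⊟-⊟ x z)) Nx+z≈0)

      conj-⊞-⊠≋⊞ : ∀ x z → N x ≈ 1ℤ → N z ≈ 1ℤ → conj (x ⊞ z) ⊠ (x ⊠ z) ≋ x ⊞ z
      conj-⊞-⊠≋⊞ x z Nx≈1 Nz≈1 = begin
        conj (x ⊞ z) ⊠ (x ⊠ z)  ≡⟨ conj-⊞-⊠ x z ⟩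
        N z ⋆ x ⊞ N x ⋆ z        ≈⟨ ⊞-cong (⋆-congʳ x Nz≈1) (⋆-congʳ z Nx≈1) ⟩
        1ℤ ⋆ x ⊞ 1ℤ ⋆ z          ≡⟨ cong₂ _⊞_ (⋆-identityˡ x) (⋆-identityˡ z) ⟩
        x ⊞ z                    ∎
        where open ≋-Reasoning

      module _ (x y z w : Q) (Nx≈1 : N x ≈ 1ℤ) (Ny≈1 : N y ≈ 1ℤ) (Nz≈1 : N z ≈ 1ℤ) (Nw≈1 : N w ≈ 1ℤ)
               (x+z≋y+w : x ⊞ z ≋ y ⊞ w) where

        N≈0⊎⊠≋ : N (x ⊞ z) ≈ 0ℤ ⊎ x ⊠ z ≋ y ⊠ w
        N≈0⊎⊠≋ = ⋆-cancel (begin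
          N (x ⊞ z) ⋆ (x ⊠ z)
            ≡⟨ ⊠-conj-cancelˡ (x ⊞ z) (x ⊠ z) ⟨
          (x ⊞ z) ⊠ (conj (x ⊞ z) ⊠ (x ⊠ z))
            ≈⟨ ⊠-congˡ (x ⊞ z) (conj-⊞-⊠≋⊞ x z Nx≈1 Nz≈1) ⟩
          (x ⊞ z) ⊠ (x ⊞ z)
            ≈⟨ ⊠-congˡ (x ⊞ z) x+z≋y+w ⟩
          (x ⊞ z) ⊠ (y ⊞ w)
            ≈⟨ ⊠-congˡ (x ⊞ z) (conj-⊞-⊠≋⊞ y w Ny≈1 Nw≈1) ⟨
          (x ⊞ z) ⊠ (conj (y ⊞ w) ⊠ (y ⊠ w))
            ≈⟨ ⊠-congˡ (x ⊞ z) (⊠-congʳ (y ⊠ w) (conj-cong x+z≋y+w)) ⟨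
          (x ⊞ z) ⊠ (conj (x ⊞ z) ⊠ (y ⊠ w))
            ≡⟨ ⊠-conj-cancelˡ (x ⊞ z) (y ⊠ w) ⟩
          N (x ⊞ z) ⋆ (y ⊠ w) ∎)
          where open ≋-Reasoning

        ⊟⊠⊟≋𝟘 : x ⊠ z ≋ y ⊠ w → (y ⊟ x) ⊠ (y ⊟ z) ≋ 𝟘
        ⊟⊠⊟≋𝟘 xz≋yw = begin
          (y ⊟ x) ⊠ (y ⊟ z)
            ≡⟨ ⊟-⊠-⊟ x y z w ⟩
          y ⊠ ((y ⊞ w) ⊟ (x ⊞ z)) ⊞ (x ⊠ z ⊟ y ⊠ w)
            ≈⟨ ⊞-cong (⊠-congˡ y (≋⇒⊟≋𝟘 (≋-sym x+z≋y+w))) (≋⇒⊟≋𝟘 xz≋yw) ⟩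
          y ⊠ 𝟘 ⊞ 𝟘
            ≡⟨ trans (⊞-identityʳ (y ⊠ 𝟘)) (⊠-zeroʳ y) ⟩
          𝟘 ∎
          where open ≋-Reasoning

        ⊠≋⇒≋⊎≋ : x ⊠ z ≋ y ⊠ w → y ≋ x ⊎ y ≋ z
        ⊠≋⇒≋⊎≋ xz≋yw =
          Sum.map (N[x⊟y]≈0⇒x≋y y x Ny≈1 Nx≈1) (N[x⊟y]≈0⇒x≋y y z Ny≈1 Nz≈1) (*≈0⇒ prime (begin
            N (y ⊟ x) * N (y ⊟ z)   ≡⟨ N-⊠ (y ⊟ x) (y ⊟ z) ⟨
            N ((y ⊟ x) ⊠ (y ⊟ z))   ≈⟨ N-cong (⊟⊠⊟≋𝟘 xz≋yw) ⟩
            N 𝟘                     ≡⟨ N-𝟘 ⟩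
            0ℤ                      ∎))
          where open ≈-Reasoning

        ⊞≋⊞⇒paired⊎opposite : (x ≋ y × z ≋ w) ⊎ (x ≋ w × z ≋ y) ⊎ (x ⊞ z ≋ 𝟘 × y ⊞ w ≋ 𝟘)
        ⊞≋⊞⇒paired⊎opposite =
          Sum.[ inj₂ ∘ inj₂ ∘ opposite , Sum.map₂ inj₁ ∘ Sum.map y≋x⇒ y≋z⇒ ∘ ⊠≋⇒≋⊎≋ ]′ N≈0⊎⊠≋
          where
          opposite : N (x ⊞ z) ≈ 0ℤ → x ⊞ z ≋ 𝟘 × y ⊞ w ≋ 𝟘
          opposite Nx+z≈0 =
            N[x⊞z]≈0⇒x⊞z≋𝟘 x z Nx≈1 Nz≈1 Nx+z≈0 ,
            N[x⊞z]≈0⇒x⊞z≋𝟘 y w Ny≈1 Nw≈1 (≈-trans (N-cong (≋-sym x+z≋y+w)) Nx+z≈0)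

          y≋x⇒ : y ≋ x → x ≋ y × z ≋ w
          y≋x⇒ y≋x = ≋-sym y≋x , ⊞-cancelˡ x y z w x+z≋y+w (≋-sym y≋x)

          y≋z⇒ : y ≋ z → x ≋ w × z ≋ y
          y≋z⇒ y≋z = ⊞-cancelˡ z y x w (≋-trans (≋-reflexive (⊞-comm z x)) x+z≋y+w) (≋-sym y≋z) , ≋-sym y≋z

mat-cong : ∀ {a₁ b₁ c₁ d₁ a₂ b₂ c₂ d₂} →
           a₁ ≡ a₂ → b₁ ≡ b₂ → c₁ ≡ c₂ → d₁ ≡ d₂ → mat a₁ b₁ c₁ d₁ ≡ mat a₂ b₂ c₂ d₂
mat-cong refl refl refl refl = refl

module Representation (A : M2) where
  open import Data.Integer.Base using (_+_; _*_; _-_; -_)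
  open QuadraticInteger (tr A)

  φ : Q → M2
  φ (u₁ , u₂) = mat (u₁ * a A + u₂) (u₁ * b A) (u₁ * c A) (u₁ * d A + u₂)

  φ-⊞ : ∀ u v → φ (u ⊞ v) ≡ φ u ⊕ φ v
  φ-⊞ (u₁ , u₂) (v₁ , v₂) =
    mat-cong (diagonal (a A) u₁ u₂ v₁ v₂) (ℤ.*-distribʳ-+ (b A) u₁ v₁)
             (ℤ.*-distribʳ-+ (c A) u₁ v₁) (diagonal (d A) u₁ u₂ v₁ v₂)
    where
    diagonal : ∀ e u₁ u₂ v₁ v₂ → (u₁ + v₁) * e + (u₂ + v₂) ≡ (u₁ * e + u₂) + (v₁ * e + v₂)
    diagonal = solve-∀

  φ-⊟ : ∀ u v → φ (u ⊟ v) ≡ φ u ⊖ φ v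
  φ-⊟ (u₁ , u₂) (v₁ , v₂) =
    mat-cong (diagonal (a A) u₁ u₂ v₁ v₂) (off-diagonal (b A) u₁ v₁)
             (off-diagonal (c A) u₁ v₁) (diagonal (d A) u₁ u₂ v₁ v₂)
    where
    diagonal : ∀ e u₁ u₂ v₁ v₂ → (u₁ - v₁) * e + (u₂ - v₂) ≡ (u₁ * e + u₂) - (v₁ * e + v₂)
    diagonal = solve-∀
    off-diagonal : ∀ e u₁ v₁ → (u₁ - v₁) * e ≡ u₁ * e - v₁ * e
    off-diagonal = solve-∀

  ·-φ : ∀ n u → n · φ u ≡ ( proj₁ u * proj₁ (n · A) + proj₂ u * proj₁ n
                          , proj₁ u * proj₂ (n · A) + proj₂ u * proj₂ n)
  ·-φ (x , y) (u₁ , u₂) = cong₂ _,_ (first x y (a A) (c A) u₁ u₂) (second x y (b A) (d A) u₁ u₂)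
    where
    first : ∀ x y e f u₁ u₂ → x * (u₁ * e + u₂) + y * (u₁ * f) ≡ u₁ * (x * e + y * f) + u₂ * x
    first = solve-∀
    second : ∀ x y e f u₁ u₂ → x * (u₁ * e) + y * (u₁ * f + u₂) ≡ u₁ * (x * e + y * f) + u₂ * y
    second = solve-∀

  module _ (det≡1 : det A ≡ 1ℤ) where

    private
      det-correction : ∀ u₁ e → e + u₁ * (1ℤ - det A) ≡ e
      det-correction u₁ e = begin
        e + u₁ * (1ℤ - det A)  ≡⟨ cong (λ δ → e + u₁ * (1ℤ - δ)) det≡1 ⟩
        e + u₁ * 0ℤ            ≡⟨ cong (_+_ e) (ℤ.*-zeroʳ u₁) ⟩
        e + 0ℤ                 ≡⟨ ℤ.+-identityʳ e ⟩
        e                      ∎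
        where open ≡-Reasoning

    -- Cayley–Hamilton: A² = (tr A) A − I, so multiplication by A corresponds to multiplication by θ.
    ⊗-φ : ∀ u → A ⊗ φ u ≡ φ (θ ⊠ u)
    ⊗-φ u@(u₁ , u₂) = begin
      A ⊗ φ u
        ≡⟨ mat-cong (trans (e₁₁ (a A) (b A) (c A) (d A) u₁ u₂) (det-correction u₁ _))
                    (e₁₂ (a A) (b A) (d A) u₁ u₂) (e₂₁ (a A) (c A) (d A) u₁ u₂)
                    (trans (e₂₂ (a A) (b A) (c A) (d A) u₁ u₂) (det-correction u₁ _)) ⟩
      φ (tr A * u₁ + u₂ , - u₁)
        ≡⟨ cong φ (θ-⊠ u) ⟨
      φ (θ ⊠ u) ∎
      where
      open ≡-Reasoning
      e₁₁ : ∀ a b c d u₁ u₂ → a * (u₁ * a + u₂) + b * (u₁ * c)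
                             ≡ ((a + d) * u₁ + u₂) * a + - u₁ + u₁ * (1ℤ - (a * d - b * c))
      e₁₁ = solve-∀
      e₁₂ : ∀ a b d u₁ u₂ → a * (u₁ * b) + b * (u₁ * d + u₂) ≡ ((a + d) * u₁ + u₂) * b
      e₁₂ = solve-∀
      e₂₁ : ∀ a c d u₁ u₂ → c * (u₁ * a + u₂) + d * (u₁ * c) ≡ ((a + d) * u₁ + u₂) * c
      e₂₁ = solve-∀
      e₂₂ : ∀ a b c d u₁ u₂ → c * (u₁ * b) + d * (u₁ * d + u₂)
                             ≡ ((a + d) * u₁ + u₂) * d + - u₁ + u₁ * (1ℤ - (a * d - b * c))
      e₂₂ = solve-∀

    -- φ 𝟙 computes to I₂, as 0ℤ * x reduces to 0ℤ.
    ^ᴹ≡φ : ∀ m → A ^ᴹ m ≡ φ (θ ^ m)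
    ^ᴹ≡φ zero    = refl
    ^ᴹ≡φ (suc m) = trans (cong (A ⊗_) (^ᴹ≡φ m)) (⊗-φ (θ ^ m))

module RepresentationModP (A : M2) (p : ℕ) where
  open import Data.Integer.Base using (_+_; _*_; _-_; -_)
  open Congruence p
  open QuadraticModP p (tr A)
  open Representation A

  φ-cong : ∀ {u v} → u ≋ v → M≡[ p ] (φ u) (φ v)
  φ-cong (u₁≈v₁ , u₂≈v₂) =
    to ≈⇔≡0 (+-cong (*-cong u₁≈v₁ ≈-refl) u₂≈v₂) , to ≈⇔≡0 (*-cong u₁≈v₁ ≈-refl) ,
    to ≈⇔≡0 (*-cong u₁≈v₁ ≈-refl) , to ≈⇔≡0 (+-cong (*-cong u₁≈v₁ ≈-refl) u₂≈v₂)
    where open Equivalence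

  discriminant≉0 : det A ≡ 1ℤ → DistinctEigenvaluesMod p A → ¬ tr A * tr A - + 4 ≈ 0ℤ
  discriminant≉0 det≡1 distinct =
    subst (λ δ → ¬ (tr A * tr A - + 4 * δ) ≡0[ p ]) det≡1 distinct ∘ Equivalence.to ≈0⇔≡0

  module _ (n : V2) (indep : LinIndepMod p (n · A) n) where

    φ-reflects-𝟘 : ∀ u → V≡0 (n · φ u) p → u ≋ 𝟘
    φ-reflects-𝟘 u@(u₁ , u₂) n·φu≡0 =
      let u₁≡0 , u₂≡0 = indep u₁ u₂ (subst (λ v → V≡0 v p) (·-φ n u) n·φu≡0)
      in from ≈0⇔≡0 u₁≡0 , from ≈0⇔≡0 u₂≡0
      where open Equivalence

    φ-injective : ∀ u v → M≡[ p ] (φ u) (φ v) → u ≋ v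
    φ-injective u v (e₁₁ , e₁₂ , e₂₁ , e₂₂) =
      ⊟≋𝟘⇒≋ (φ-reflects-𝟘 (u ⊟ v) (subst (λ X → V≡0 (n · X) p) (sym (φ-⊟ u v)) n·[φu⊖φv]≡0))
      where
      n·[φu⊖φv]≡0 : V≡0 (n · (φ u ⊖ φ v)) p
      n·[φu⊖φv]≡0 = ≡0-linear (proj₁ n) (proj₂ n) _ _ e₁₁ e₂₁ , ≡0-linear (proj₁ n) (proj₂ n) _ _ e₁₂ e₂₂

    module _ (det≡1 : det A ≡ 1ℤ) where

      Good⇒⊞≋⊞ : ∀ i j k l → Good A p n (i , j , k , l) → θ ^ i ⊞ θ ^ k ≋ θ ^ j ⊞ θ ^ l
      Good⇒⊞≋⊞ i j k l good =
        alternating≋𝟘⇒ (θ ^ i) (θ ^ j) (θ ^ k) (θ ^ l)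
          (φ-reflects-𝟘 ((θ ^ i ⊟ θ ^ j) ⊞ (θ ^ k ⊟ θ ^ l)) (subst (λ X → V≡0 (n · X) p) as-φ good))
        where
        open ≡-Reasoning
        as-φ : ((A ^ᴹ i) ⊖ (A ^ᴹ j)) ⊕ ((A ^ᴹ k) ⊖ (A ^ᴹ l)) ≡ φ ((θ ^ i ⊟ θ ^ j) ⊞ (θ ^ k ⊟ θ ^ l))
        as-φ = begin
          ((A ^ᴹ i) ⊖ (A ^ᴹ j)) ⊕ ((A ^ᴹ k) ⊖ (A ^ᴹ l))
            ≡⟨ cong₂ _⊕_ (cong₂ _⊖_ (^ᴹ≡φ det≡1 i) (^ᴹ≡φ det≡1 j)) (cong₂ _⊖_ (^ᴹ≡φ det≡1 k) (^ᴹ≡φ det≡1 l)) ⟩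
          (φ (θ ^ i) ⊖ φ (θ ^ j)) ⊕ (φ (θ ^ k) ⊖ φ (θ ^ l))
            ≡⟨ cong₂ _⊕_ (φ-⊟ (θ ^ i) (θ ^ j)) (φ-⊟ (θ ^ k) (θ ^ l)) ⟨
          φ (θ ^ i ⊟ θ ^ j) ⊕ φ (θ ^ k ⊟ θ ^ l)
            ≡⟨ φ-⊞ (θ ^ i ⊟ θ ^ j) (θ ^ k ⊟ θ ^ l) ⟨
          φ ((θ ^ i ⊟ θ ^ j) ⊞ (θ ^ k ⊟ θ ^ l)) ∎

      θ-order : ∀ K → IsOrd A p K → θ ^ K ≋ 𝟙 × (∀ m → 1 ≤ m → m < K → ¬ θ ^ m ≋ 𝟙)
      θ-order K (_ , A^K≡I , A^m≢I) =
        φ-injective (θ ^ K) 𝟙 (subst (λ X → M≡[ p ] X I₂) (^ᴹ≡φ det≡1 K) A^K≡I) ,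
        λ m 1≤m m<K θ^m≋𝟙 →
          A^m≢I m 1≤m m<K (subst (λ X → M≡[ p ] X I₂) (sym (^ᴹ≡φ det≡1 m)) (φ-cong θ^m≋𝟙))

open import Data.Nat using (_+_; _*_)

private
  variable
    ℓ ℓ₁ ℓ₂ ℓ₃ : Level
    A : Set ℓ₁
    B : Set ℓ₂
    C : Set ℓ₃

Unique-map⁺ : {f : A → B} {xs : List A} →
              (∀ {x y} → x ∈ xs → y ∈ xs → f x ≡ f y → x ≡ y) →
              Unique xs → Unique (map f xs)
Unique-map⁺ inj [] = []
Unique-map⁺ inj (x∉xs ∷ xs!) =
  All.map⁺ (All.tabulate λ y∈xs fx≡fy → All.lookup x∉xs y∈xs (inj (here refl) (there y∈xs) fx≡fy))
  ∷ Unique-map⁺ (λ x∈ y∈ → inj (there x∈) (there y∈)) xs!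

Unique-⊆⇒length≤ : {xs ys : List A} → Unique xs → xs ⊆ ys → length xs ≤ length ys
Unique-⊆⇒length≤ {xs = []} _ _ = z≤n
Unique-⊆⇒length≤ {xs = x ∷ xs} (x∉xs ∷ xs!) xs⊆ys
  with ys₁ , ys₂ , refl ← ∈-∃++ (xs⊆ys (here refl)) = begin
    suc (length xs)           ≤⟨ s≤s (Unique-⊆⇒length≤ xs! xs⊆ys₁++ys₂) ⟩
    suc (length (ys₁ ++ ys₂)) ≡⟨ length-++-sucʳ ys₁ x ys₂ ⟨
    length (ys₁ ++ x ∷ ys₂)   ∎
  where
  open ℕ.≤-Reasoning
  xs⊆ys₁++ys₂ : xs ⊆ ys₁ ++ ys₂
  xs⊆ys₁++ys₂ {y} y∈xs with ∈-++⁻ ys₁ (xs⊆ys (there y∈xs))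
  ... | inj₁ y∈ys₁         = ∈-++⁺ˡ y∈ys₁
  ... | inj₂ (here refl)   = contradiction refl (All.lookup x∉xs y∈xs)
  ... | inj₂ (there y∈ys₂) = ∈-++⁺ʳ ys₁ y∈ys₂

length≤-injection : (f : A → B) {xs : List A} {ys : List B} → Unique xs →
                    (∀ {x} → x ∈ xs → f x ∈ ys) →
                    (∀ {x y} → x ∈ xs → y ∈ xs → f x ≡ f y → x ≡ y) →
                    length xs ≤ length ys
length≤-injection f {xs} {ys} xs! f∈ys inj = begin
  length xs         ≡⟨ length-map f xs ⟨
  length (map f xs) ≤⟨ Unique-⊆⇒length≤ (Unique-map⁺ inj xs!) map⊆ys ⟩
  length ys         ∎
  where
  open ℕ.≤-Reasoning
  map⊆ys : map f xs ⊆ ys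
  map⊆ys fx∈ with _ , x∈xs , refl ← ∈-map⁻ f fx∈ = f∈ys x∈xs

module _ {P : Pred A ℓ} (P? : Decidable P) {xs : List A} (xs! : Unique xs) where

  length-filter≤-injection : (f : A → B) {ys : List B} →
                             (∀ {x} → x ∈ xs → P x → f x ∈ ys) →
                             (∀ {x y} → x ∈ xs → y ∈ xs → P x → P y → f x ≡ f y → x ≡ y) →
                             length (filter P? xs) ≤ length ys
  length-filter≤-injection f f∈ys inj =
    length≤-injection f (Unique.filter⁺ P? xs!)
      (λ x∈ → let x∈xs , Px = ∈-filter⁻ P? x∈ in f∈ys x∈xs Px)
      (λ x∈ y∈ → let x∈xs , Px = ∈-filter⁻ P? x∈
                     y∈xs , Py = ∈-filter⁻ P? y∈
                 in inj x∈xs y∈xs Px Py)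

  length-filter≤-⊎ : {Q : Pred A ℓ₁} {R : Pred A ℓ₂} {S : Pred A ℓ₃}
                     (Q? : Decidable Q) (R? : Decidable R) (S? : Decidable S) →
                     (∀ {x} → x ∈ xs → P x → Q x ⊎ R x ⊎ S x) →
                     length (filter P? xs)
                       ≤ length (filter Q? xs) + (length (filter R? xs) + length (filter S? xs))
  length-filter≤-⊎ Q? R? S? cover = begin
    length (filter P? xs)
      ≤⟨ length-filter≤-injection id covered (λ _ _ _ _ → id) ⟩
    length (filter Q? xs ++ filter R? xs ++ filter S? xs)
      ≡⟨ length-++ (filter Q? xs) ⟩
    length (filter Q? xs) + length (filter R? xs ++ filter S? xs)
      ≡⟨ cong (_+_ (length (filter Q? xs))) (length-++ (filter R? xs)) ⟩
    length (filter Q? xs) + (length (filter R? xs) + length (filter S? xs)) ∎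
    where
    open ℕ.≤-Reasoning
    covered : ∀ {x} → x ∈ xs → P x → x ∈ filter Q? xs ++ filter R? xs ++ filter S? xs
    covered x∈xs Px with cover x∈xs Px
    ... | inj₁ Qx        = ∈-++⁺ˡ (∈-filter⁺ Q? x∈xs Qx)
    ... | inj₂ (inj₁ Rx) = ∈-++⁺ʳ (filter Q? xs) (∈-++⁺ˡ (∈-filter⁺ R? x∈xs Rx))
    ... | inj₂ (inj₂ Sx) = ∈-++⁺ʳ (filter Q? xs) (∈-++⁺ʳ (filter R? xs) (∈-filter⁺ S? x∈xs Sx))

length-cartesianProduct : (xs : List A) (ys : List B) →
                          length (cartesianProduct xs ys) ≡ length xs * length ys
length-cartesianProduct [] ys = refl
length-cartesianProduct (x ∷ xs) ys = begin
  length (map (x ,_) ys ++ cartesianProduct xs ys)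
    ≡⟨ length-++ (map (x ,_) ys) ⟩
  length (map (x ,_) ys) + length (cartesianProduct xs ys)
    ≡⟨ cong₂ _+_ (length-map (x ,_) ys) (length-cartesianProduct xs ys) ⟩
  length ys + length xs * length ys ∎
  where open ≡-Reasoning

concatMap-map-cartesianProduct : (f : A × B → C) (xs : List A) (ys : List B) →
                                 concatMap (λ x → map (λ y → f (x , y)) ys) xs
                                   ≡ map f (cartesianProduct xs ys)
concatMap-map-cartesianProduct f [] ys = refl
concatMap-map-cartesianProduct f (x ∷ xs) ys = begin
  map (λ y → f (x , y)) ys ++ concatMap (λ x → map (λ y → f (x , y)) ys) xs
    ≡⟨ cong₂ _++_ (map-∘ ys) (concatMap-map-cartesianProduct f xs ys) ⟩
  map f (map (x ,_) ys) ++ map f (cartesianProduct xs ys)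
    ≡⟨ map-++ f (map (x ,_) ys) (cartesianProduct xs ys) ⟨
  map f (map (x ,_) ys ++ cartesianProduct xs ys) ∎
  where open ≡-Reasoning

Quad : Set
Quad = ℕ × ℕ × ℕ × ℕ

module _ (K : ℕ) where

  private
    R : List ℕ
    R = range1 K

  range1-unique : Unique R
  range1-unique = Unique.map⁺ ℕ.suc-injective (Unique.upTo⁺ K)

  ∈-range1⁻ : ∀ {i} → i ∈ R → 1 ≤ i × i ≤ K
  ∈-range1⁻ i∈R with _ , j∈ , refl ← ∈-map⁻ suc i∈R = s≤s z≤n , ∈-upTo⁻ j∈

  length-range1 : length R ≡ K
  length-range1 = trans (length-map suc (upTo K)) (length-applyUpTo id K)

  quads≡ : quads K ≡ cartesianProduct R (cartesianProduct R (cartesianProduct R R))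
  quads≡ = begin
    quads K
      ≡⟨ concatMap-cong (λ i → concatMap-cong (λ j →
           concatMap-map-cartesianProduct (λ kl → i , j , kl) R R) R) R ⟩
    concatMap (λ i → concatMap (λ j → map (λ kl → i , j , kl) (cartesianProduct R R)) R) R
      ≡⟨ concatMap-cong (λ i → concatMap-map-cartesianProduct (i ,_) R (cartesianProduct R R)) R ⟩
    concatMap (λ i → map (i ,_) (cartesianProduct R (cartesianProduct R R))) R
      ≡⟨ concatMap-map-cartesianProduct id R (cartesianProduct R (cartesianProduct R R)) ⟩
    map id (cartesianProduct R (cartesianProduct R (cartesianProduct R R)))
      ≡⟨ map-id _ ⟩
    cartesianProduct R (cartesianProduct R (cartesianProduct R R)) ∎
    where open ≡-Reasoning

  quads-unique : Unique (quads K)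
  quads-unique = subst Unique (sym quads≡)
    (Unique.cartesianProduct⁺ range1-unique
      (Unique.cartesianProduct⁺ range1-unique
        (Unique.cartesianProduct⁺ range1-unique range1-unique)))

  ∈-quads⁻ : ∀ {i j k l} → (i , j , k , l) ∈ quads K → i ∈ R × j ∈ R × k ∈ R × l ∈ R
  ∈-quads⁻ q∈ with i∈ , jkl∈ ← ∈-cartesianProduct⁻ R _ (subst ((_ , _ , _ , _) ∈_) quads≡ q∈)
    with j∈ , kl∈ ← ∈-cartesianProduct⁻ R _ jkl∈
    with k∈ , l∈ ← ∈-cartesianProduct⁻ R R kl∈ = i∈ , j∈ , k∈ , l∈

Cancelling₁ Cancelling₂ : Pred Quad 0ℓ
Cancelling₁ (i , j , k , l) = i ≡ j × k ≡ l
Cancelling₂ (i , j , k , l) = i ≡ l × k ≡ j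

Opposite : Rel ℕ ℓ → Pred Quad ℓ
Opposite _~_ (i , j , k , l) = i ~ k × j ~ l

module _ (K : ℕ) {_~_ : Rel ℕ ℓ} (_~?_ : B.Decidable _~_)
         (~-functional : ∀ i {k k′} → k ∈ range1 K → k′ ∈ range1 K → i ~ k → i ~ k′ → k ≡ k′) where

  Cancelling₁? : Decidable Cancelling₁
  Cancelling₁? (i , j , k , l) = (i ≟ j) ×-dec (k ≟ l)

  Cancelling₂? : Decidable Cancelling₂
  Cancelling₂? (i , j , k , l) = (i ≟ l) ×-dec (k ≟ j)

  Opposite? : Decidable (Opposite _~_)
  Opposite? (i , j , k , l) = (i ~? k) ×-dec (j ~? l)

  private
    pairs : List (ℕ × ℕ)
    pairs = cartesianProduct (range1 K) (range1 K)

    ≤K*K : ∀ {P : Pred Quad ℓ₁} (P? : Decidable P) (f : Quad → ℕ × ℕ) →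
           (∀ {q} → q ∈ quads K → P q → f q ∈ pairs) →
           (∀ {q q′} → q ∈ quads K → q′ ∈ quads K → P q → P q′ → f q ≡ f q′ → q ≡ q′) →
           length (filter P? (quads K)) ≤ K * K
    ≤K*K P? f f∈ inj = begin
      length (filter P? (quads K))  ≤⟨ length-filter≤-injection P? (quads-unique K) f f∈ inj ⟩
      length pairs                  ≡⟨ length-cartesianProduct (range1 K) (range1 K) ⟩
      length (range1 K) * length (range1 K)
                                    ≡⟨ cong₂ _*_ (length-range1 K) (length-range1 K) ⟩
      K * K                         ∎
      where open ℕ.≤-Reasoning

    Cancelling₁≤ : length (filter Cancelling₁? (quads K)) ≤ K * K
    Cancelling₁≤ = ≤K*K Cancelling₁? (λ (i , _ , k , _) → i , k)
      (λ q∈ _ → let i∈ , _ , k∈ , _ = ∈-quads⁻ K q∈ in ∈-cartesianProduct⁺ i∈ k∈)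
      (λ { _ _ (refl , refl) (refl , refl) refl → refl })

    Cancelling₂≤ : length (filter Cancelling₂? (quads K)) ≤ K * K
    Cancelling₂≤ = ≤K*K Cancelling₂? (λ (i , j , _ , _) → i , j)
      (λ q∈ _ → let i∈ , j∈ , _ = ∈-quads⁻ K q∈ in ∈-cartesianProduct⁺ i∈ j∈)
      (λ { _ _ (refl , refl) (refl , refl) refl → refl })

    Opposite≤ : length (filter Opposite? (quads K)) ≤ K * K
    Opposite≤ = ≤K*K Opposite? (λ (i , j , _ , _) → i , j)
      (λ q∈ _ → let i∈ , j∈ , _ = ∈-quads⁻ K q∈ in ∈-cartesianProduct⁺ i∈ j∈)
      λ { q∈ q′∈ (i~k , j~l) (i~k′ , j~l′) refl →
          let _ , _ , k∈ , l∈ = ∈-quads⁻ K q∈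
              _ , _ , k′∈ , l′∈ = ∈-quads⁻ K q′∈
          in cong₂ (λ k l → _ , _ , k , l) (~-functional _ k∈ k′∈ i~k i~k′) (~-functional _ l∈ l′∈ j~l j~l′) }

  length-filter-quads≤ : {G : Pred Quad ℓ₁} (G? : Decidable G) →
                         (∀ {q} → q ∈ quads K → G q → Cancelling₁ q ⊎ Cancelling₂ q ⊎ Opposite _~_ q) →
                         length (filter G? (quads K)) ≤ 3 * (K * K)
  length-filter-quads≤ G? cover = begin
    length (filter G? (quads K))
      ≤⟨ length-filter≤-⊎ G? (quads-unique K) Cancelling₁? Cancelling₂? Opposite? cover ⟩
    length (filter Cancelling₁? (quads K))
      + (length (filter Cancelling₂? (quads K)) + length (filter Opposite? (quads K)))
      ≤⟨ ℕ.+-mono-≤ Cancelling₁≤ (ℕ.+-mono-≤ Cancelling₂≤ Opposite≤) ⟩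
    K * K + (K * K + K * K)
      ≡⟨ cong (λ n → K * K + (K * K + n)) (ℕ.+-identityʳ (K * K)) ⟨
    3 * (K * K) ∎
    where open ℕ.≤-Reasoning

module PowersOfθ (A : M2) (p : ℕ) (n : V2) (indep : LinIndepMod p (n · A) n)
                 (det≡1 : det A ≡ 1ℤ) (K : ℕ) (ord : IsOrd A p K) where
  open Congruence p using (_≈_; ≈-reflexive)
  open QuadraticModP p (tr A)
  open RepresentationModP A p

  θ^-injective : ∀ {i j} → i ∈ range1 K → j ∈ range1 K → θ ^ i ≋ θ ^ j → i ≡ j
  θ^-injective i∈ j∈ =
    let θ^K≋𝟙 , θ^m≉𝟙 = θ-order n indep det≡1 K ord
        1≤i , i≤K = ∈-range1⁻ K i∈
        1≤j , j≤K = ∈-range1⁻ K j∈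
    in ^-injective θ^K≋𝟙 θ^m≉𝟙 1≤i i≤K 1≤j j≤K

  Antipodal : Rel ℕ 0ℓ
  Antipodal i k = θ ^ i ⊞ θ ^ k ≋ 𝟘

  Antipodal? : B.Decidable Antipodal
  Antipodal? i k = θ ^ i ⊞ θ ^ k ≋? 𝟘

  Antipodal-unique : ∀ i {k k′} → k ∈ range1 K → k′ ∈ range1 K →
                     Antipodal i k → Antipodal i k′ → k ≡ k′
  Antipodal-unique i {k} {k′} k∈ k′∈ i~k i~k′ =
    θ^-injective k∈ k′∈ (⊞-cancelˡ (θ ^ i) (θ ^ i) (θ ^ k) (θ ^ k′) (≋-trans i~k (≋-sym i~k′)) ≋-refl)

  Good⇒solution : Prime p → DistinctEigenvaluesMod p A → ∀ {q} → q ∈ quads K → Good A p n q →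
                  Cancelling₁ q ⊎ Cancelling₂ q ⊎ Opposite Antipodal q
  Good⇒solution p-prime distinct {i , j , k , l} q∈ good =
    let i∈ , j∈ , k∈ , l∈ = ∈-quads⁻ K q∈ in
    Sum.map (Product.map (θ^-injective i∈ j∈) (θ^-injective k∈ l∈))
            (Sum.map₁ (Product.map (θ^-injective i∈ l∈) (θ^-injective k∈ j∈)))
            (⊞≋⊞⇒paired⊎opposite p-prime (discriminant≉0 det≡1 distinct) (θ ^ i) (θ ^ j) (θ ^ k) (θ ^ l)
               (norm-one i) (norm-one j) (norm-one k) (norm-one l) (Good⇒⊞≋⊞ n indep det≡1 i j k l good))
    where
    norm-one : ∀ m → N (θ ^ m) ≈ 1ℤ
    norm-one m = ≈-reflexive (N-θ^ m)

lemma1 : (A : M2) → InSL2 A → 2 < ∣ tr A ∣ →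
         (p : ℕ) → Prime p → (n : V2) →
         LinIndepMod p (n · A) n →
         DistinctEigenvaluesMod p A →
         (K : ℕ) → IsOrd A p K →
         count A p n K ≤ 3 * (K * K)
lemma1 A det≡1 _ p p-prime n indep distinct K ord =
  length-filter-quads≤ K Antipodal? Antipodal-unique (Good? A p n) (Good⇒solution p-prime distinct)
  where open PowersOfθ A p n indep det≡1 K ord
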